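{- Let $G=(V,E)$ be an undirected graph with edge weight function $w:E\to\mathbb{Z}_{\ge 0}$, interdiction cost function $c:E\to\mathbb{Z}_{\ge 0}$, and budget $B>0$, such that for every $I\subseteq E$ with $c(I)\le B$ the graph $G\setminus I$ has a perfect matching. Let $W=\max_{e\in E}w(e)$, define $w':E\to\mathbb{Z}_{\ge 0}$ by $w'(e)=W-w(e)$, and define $w''(e)=w'(e)+2\nu_{w'}(G)+2$. Then for every $I\subseteq E$ with $c(I)\le B$, $$\gamma_{w'}(G\setminus I)+|V|\,\nu_{w'}(G)+|V|=\nu_{w''}(G\setminus I).$$
   Context: $G\setminus I$ is $G$ with the edges of $I$ deleted; $c(I)=\sum_{e\in I}c(e)$. For a weight function $x$ on edges and a graph $H$, $\nu_x(H)$ is the maximum $x$-weight of a matching in $H$, and $\gamma_x(H)$ is the maximum $x$-weight of a perfect matching in $H$ (a matching covering all vertices). -}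

module Defs where

open import Data.Nat using (ℕ; zero; suc; _+_; _*_; _∸_; _⊔_; _≤_; _<_)
open import Data.Fin using (Fin; _≟_)
import Data.Fin
import Data.Fin.Subset
open import Data.Fin.Properties using (all?; any?)
open import Data.Fin.Subset using (Subset; inside; outside; _∈_; _∉_)
open import Data.Fin.Subset.Properties using (_∈?_)
open import Data.Product using (_×_; _,_; proj₁; proj₂; ∃)
open import Data.Sum using (_⊎_)
open import Data.List using (List; []; _∷_; map; _++_; foldr; filter)
open import Data.Vec using ([]; _∷_)
open import Relation.Binary.PropositionalEquality using (_≡_)
open import Relation.Nullary using (¬_; Dec; yes; no)
open import Relation.Nullary.Decidable using (¬?; _×-dec_; _⊎-dec_; _→-dec_)

record Graph : Set where
  field
    n    : ℕ
    m    : ℕ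
    end₁ : Fin m → Fin n
    end₂ : Fin m → Fin n

open Graph public

Incident : (G : Graph) → Fin (n G) → Fin (m G) → Set
Incident G v e = (end₁ G e ≡ v) ⊎ (end₂ G e ≡ v)

IsSimple : Graph → Set
IsSimple G =
  (∀ e → ¬ (end₁ G e ≡ end₂ G e)) ×
  (∀ e f → (∀ v → Incident G v e → Incident G v f) → e ≡ f)

sumFin : ∀ {k} → (Fin k → ℕ) → ℕ
sumFin {zero}  f = 0
sumFin {suc k} f = f Data.Fin.zero + sumFin (λ i → f (Data.Fin.suc i))

indicator : ∀ {k} → Subset k → (Fin k → ℕ) → Fin k → ℕ
indicator S x e with e ∈? S
... | yes _ = x e
... | no  _ = 0

weight : ∀ {k} → (Fin k → ℕ) → Subset k → ℕ
weight x S = sumFin (indicator S x)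

-- M is a matching of G ∖ I : it uses only edges not in I, and any two
-- distinct edges of M share no endpoint.
IsMatching : (G : Graph) → (I M : Subset (m G)) → Set
IsMatching G I M =
  (∀ e → e ∈ M → e ∉ I) ×
  (∀ e f → e ∈ M → f ∈ M → ¬ (e ≡ f) → ∀ v → Incident G v e → ¬ Incident G v f)

IsPerfectMatching : (G : Graph) → (I M : Subset (m G)) → Set
IsPerfectMatching G I M =
  IsMatching G I M × (∀ v → ∃ λ e → e ∈ M × Incident G v e)

HasPerfectMatching : (G : Graph) → Subset (m G) → Set
HasPerfectMatching G I = ∃ λ M → IsPerfectMatching G I M

incident? : (G : Graph) → ∀ v e → Dec (Incident G v e)
incident? G v e = (end₁ G e ≟ v) ⊎-dec (end₂ G e ≟ v)

isMatching? : (G : Graph) → (I M : Subset (m G)) → Dec (IsMatching G I M)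
isMatching? G I M =
  all? (λ e → (e ∈? M) →-dec ¬? (e ∈? I)) ×-dec
  all? (λ e → all? (λ f → (e ∈? M) →-dec ((f ∈? M) →-dec (¬? (e ≟ f) →-dec
    all? (λ v → incident? G v e →-dec ¬? (incident? G v f))))))

isPerfectMatching? : (G : Graph) → (I M : Subset (m G)) → Dec (IsPerfectMatching G I M)
isPerfectMatching? G I M =
  isMatching? G I M ×-dec all? (λ v → any? (λ e → (e ∈? M) ×-dec incident? G v e))

allSubsets : (k : ℕ) → List (Subset k)
allSubsets zero    = [] ∷ []
allSubsets (suc k) = map (inside ∷_) (allSubsets k) ++ map (outside ∷_) (allSubsets k)

maxList : List ℕ → ℕ
maxList = foldr _⊔_ 0

ν : (G : Graph) → (Fin (m G) → ℕ) → Subset (m G) → ℕ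
ν G x I = maxList (map (weight x) (filter (isMatching? G I) (allSubsets (m G))))

-- γ_x(G ∖ I): maximum x-weight of a perfect matching in G ∖ I
-- (only meaningful when G ∖ I has a perfect matching; 0 otherwise)
γ : (G : Graph) → (Fin (m G) → ℕ) → Subset (m G) → ℕ
γ G x I = maxList (map (weight x) (filter (isPerfectMatching? G I) (allSubsets (m G))))

noEdges : (k : ℕ) → Subset k
noEdges k = Data.Fin.Subset.⊥

maxWeight : ∀ {k} → (Fin k → ℕ) → ℕ
maxWeight {zero}  w = 0
maxWeight {suc k} w = w Data.Fin.zero ⊔ maxWeight (λ i → w (Data.Fin.suc i))

-- Let N bound the x-weight of every matching of G ∖ I. Adding 2N + 2 to every edge weight
-- gives a matching M the bonus (N + 1) · 2|M|. Double counting edge–endpoint incidences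
-- in the loopless graph gives 2|M| = |V| when M is perfect and 2|M| ≤ |V| − 1 otherwise,
-- so an imperfect matching misses the bonus (N + 1)|V| of a perfect one by more than N,
-- hence by more than its own x-weight. The heaviest matching for the shifted weights is
-- therefore a heaviest perfect matching, of weight γ + (N + 1)|V|. The theorem takes
-- N = ν_{w′}(G), which bounds the matchings of G ∖ I since they are matchings of G.

module Submission where

open import Defs
open import Data.Nat using (ℕ; zero; suc; _+_; _*_; _∸_; _≤_; _<_; z≤n; s≤s)
open import Data.Nat.Properties
  using ( ≤-refl; ≤-trans; ≤-antisym; ≤-reflexive; n≤0⇒n≡0; n<1+n; m≤n+m; m≤m+n; ⊔-sel; ⊔-lub; m≤m⊔n; m≤n⊔m
        ; +-mono-≤; +-monoˡ-≤; +-monoˡ-<; <⇒≤; *-monoʳ-≤; *-comm; *-suc; +-*-semiring; *-identityʳ; *-zeroʳ; module ≤-Reasoning)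
open import Data.Nat.Tactic.RingSolver using (solve-∀)
open import Algebra.Properties.Semiring.Sum +-*-semiring
  using (sum; sum-cong-≗; sum-remove; ∑-comm; ∑-distrib-+; *-distribˡ-sum; *-distribʳ-sum)
open import Data.Fin using (Fin; zero; suc; _≟_; punchIn)
open import Data.Fin.Properties using (0≢1+n; suc-injective; any?; ¬∀⟶∃¬)
open import Data.Fin.Subset using (Subset; _∈_; _⊆_; inside; outside)
open import Data.Fin.Subset.Properties using (_∈?_; ⊥⊆)
open import Data.Vec.Functional using (removeAt)
open import Data.Product using (_×_; _,_; proj₁; proj₂; ∃)
open import Data.Sum using (_⊎_; inj₁; inj₂)
open import Data.List using ([]; _∷_; map; filter)
open import Data.List.Membership.Propositional using () renaming (_∈_ to _∈ˡ_)
open import Data.List.Membership.Propositional.Properties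
  using (∈-map⁺; ∈-map⁻; ∈-++⁺ˡ; ∈-++⁺ʳ; ∈-filter⁺; ∈-filter⁻)
open import Data.List.Relation.Unary.Any using (here; there)
open import Data.Vec using ([]; _∷_)
open import Data.Empty using (⊥-elim)
open import Function using (_∘_)
open import Level using (Level)
open import Relation.Binary.PropositionalEquality
  using (_≡_; refl; sym; trans; cong; cong₂; subst; module ≡-Reasoning)
open import Relation.Nullary using (¬_; Dec; yes; no)
open import Relation.Nullary.Decidable using (_⊎-dec_; _×-dec_)
open import Relation.Unary using (Pred; Decidable)

private
  variable
    ℓ : Level
    k : ℕ

∈⇒≤maxList : ∀ {x xs} → x ∈ˡ xs → x ≤ maxList xs
∈⇒≤maxList {xs = y ∷ ys} (here refl) = m≤m⊔n y (maxList ys)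
∈⇒≤maxList {xs = y ∷ ys} (there x∈ys) = ≤-trans (∈⇒≤maxList x∈ys) (m≤n⊔m y (maxList ys))

maxList-least : ∀ {b} xs → (∀ {x} → x ∈ˡ xs → x ≤ b) → maxList xs ≤ b
maxList-least []       _     = z≤n
maxList-least (y ∷ ys) ≤b = ⊔-lub (≤b (here refl)) (maxList-least ys (≤b ∘ there))

maxList-attained : ∀ xs → maxList xs ≡ 0 ⊎ maxList xs ∈ˡ xs
maxList-attained []       = inj₁ refl
maxList-attained (y ∷ ys) with ⊔-sel y (maxList ys)
... | inj₁ max≡y  = inj₂ (here max≡y)
... | inj₂ max≡ys with maxList-attained ys
...   | inj₁ ys≡0 = inj₁ (trans max≡ys ys≡0)
...   | inj₂ ∈ys  = inj₂ (there (subst (_∈ˡ ys) (sym max≡ys) ∈ys))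

∈-allSubsets : (S : Subset k) → S ∈ˡ allSubsets k
∈-allSubsets []           = here refl
∈-allSubsets (inside ∷ S)  = ∈-++⁺ˡ (∈-map⁺ (inside ∷_) (∈-allSubsets S))
∈-allSubsets {suc k} (outside ∷ S) =
  ∈-++⁺ʳ (map (inside ∷_) (allSubsets k)) (∈-map⁺ (outside ∷_) (∈-allSubsets S))

maxWeightOver : {P : Pred (Subset k) ℓ} → Decidable P → (Fin k → ℕ) → ℕ
maxWeightOver {k} P? x = maxList (map (weight x) (filter P? (allSubsets k)))

module _ {P : Pred (Subset k) ℓ} (P? : Decidable P) (x : Fin k → ℕ) where

  weight≤maxWeightOver : ∀ {S} → P S → weight x S ≤ maxWeightOver P? x
  weight≤maxWeightOver PS = ∈⇒≤maxList (∈-map⁺ (weight x) (∈-filter⁺ P? (∈-allSubsets _) PS))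

  maxWeightOver-least : ∀ {b} → (∀ S → P S → weight x S ≤ b) → maxWeightOver P? x ≤ b
  maxWeightOver-least {b} ≤b = maxList-least _ (λ y∈ → bound (∈-map⁻ (weight x) y∈))
    where
    bound : ∀ {y} → ∃ (λ S → S ∈ˡ filter P? (allSubsets k) × y ≡ weight x S) → y ≤ b
    bound (S , S∈ , refl) = ≤b S (proj₂ (∈-filter⁻ P? {xs = allSubsets k} S∈))

  maxWeightOver-attained : ∀ {S} → P S → ∃ λ T → P T × weight x T ≡ maxWeightOver P? x
  maxWeightOver-attained {S} PS with maxList-attained (map (weight x) (filter P? (allSubsets k)))
  ... | inj₁ max≡0 = S , PS , trans (n≤0⇒n≡0 (subst (weight x S ≤_) max≡0 (weight≤maxWeightOver PS)))
                                    (sym max≡0)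
  ... | inj₂ max∈ with ∈-map⁻ (weight x) max∈
  ...   | T , T∈ , max≡ = T , proj₂ (∈-filter⁻ P? {xs = allSubsets k} T∈) , sym max≡

sumFin≡sum : (f : Fin k → ℕ) → sumFin f ≡ sum f
sumFin≡sum {zero}  f = refl
sumFin≡sum {suc k} f = cong (f zero +_) (sumFin≡sum (f ∘ suc))

sum-mono-≤ : {f g : Fin k → ℕ} → (∀ i → f i ≤ g i) → sum f ≤ sum g
sum-mono-≤ {zero}  _   = z≤n
sum-mono-≤ {suc k} f≤g = +-mono-≤ (f≤g zero) (sum-mono-≤ (f≤g ∘ suc))

≤-sum : (f : Fin k → ℕ) → ∀ i → f i ≤ sum f
≤-sum f zero    = m≤m+n _ _
≤-sum f (suc i) = ≤-trans (≤-sum (f ∘ suc) i) (m≤n+m _ _)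

sum-ones : sum {k} (λ _ → 1) ≡ k
sum-ones {zero}  = refl
sum-ones {suc k} = cong suc sum-ones

sum-<-ones : (f : Fin k → ℕ) → (∀ i → f i ≤ 1) → ∀ i → f i ≡ 0 → sum f < k
sum-<-ones {suc k} f f≤1 i fi≡0 = begin-strict
  sum f                     ≡⟨ sum-remove {i = i} f ⟩
  f i + sum (removeAt f i)  ≡⟨ cong (_+ sum (removeAt f i)) fi≡0 ⟩
  sum (removeAt f i)        ≤⟨ sum-mono-≤ (λ j → f≤1 (punchIn i j)) ⟩
  sum {k} (λ _ → 1)         ≡⟨ sum-ones ⟩
  k                         <⟨ n<1+n k ⟩
  suc k                     ∎
  where open ≤-Reasoning

iverson : {A : Set ℓ} → Dec A → ℕ
iverson (yes _) = 1
iverson (no  _) = 0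

iverson-× : {A B : Set ℓ} (a? : Dec A) (b? : Dec B) → iverson (a? ×-dec b?) ≡ iverson a? * iverson b?
iverson-× (yes _) (yes _) = refl
iverson-× (yes _) (no  _) = refl
iverson-× (no  _) _       = refl

iverson-⊎ : {A B : Set ℓ} (a? : Dec A) (b? : Dec B) → ¬ (A × B) →
            iverson (a? ⊎-dec b?) ≡ iverson a? + iverson b?
iverson-⊎ (yes a) (yes b) ¬ab = ⊥-elim (¬ab (a , b))
iverson-⊎ (yes _) (no  _) _   = refl
iverson-⊎ (no  _) (yes _) _   = refl
iverson-⊎ (no  _) (no  _) _   = refl

sum-iverson-≡0 : {P : Pred (Fin k) ℓ} (P? : Decidable P) → (∀ i → ¬ P i) → sum (iverson ∘ P?) ≡ 0
sum-iverson-≡0 {zero}  P? ¬P = refl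
sum-iverson-≡0 {suc k} P? ¬P with P? zero
... | yes P0 = ⊥-elim (¬P zero P0)
... | no  _  = sum-iverson-≡0 (P? ∘ suc) (¬P ∘ suc)

sum-iverson-≤1 : {P : Pred (Fin k) ℓ} (P? : Decidable P) → (∀ {i j} → P i → P j → i ≡ j) →
                 sum (iverson ∘ P?) ≤ 1
sum-iverson-≤1 {zero}  P? unique = z≤n
sum-iverson-≤1 {suc k} P? unique with P? zero
... | yes P0 = s≤s (≤-reflexive (sum-iverson-≡0 (P? ∘ suc) (λ i Psi → 0≢1+n (unique P0 Psi))))
... | no  _  = sum-iverson-≤1 (P? ∘ suc) (λ Pi Pj → suc-injective (unique Pi Pj))

sum-iverson-≥1 : {P : Pred (Fin k) ℓ} (P? : Decidable P) → ∀ {i} → P i → 1 ≤ sum (iverson ∘ P?)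
sum-iverson-≥1 {P = P} P? {i} Pi = ≤-trans (one≤ (P? i)) (≤-sum (iverson ∘ P?) i)
  where
  one≤ : (Pi? : Dec (P i)) → 1 ≤ iverson Pi?
  one≤ (yes _)  = ≤-refl
  one≤ (no ¬Pi) = ⊥-elim (¬Pi Pi)

card : Subset k → ℕ
card S = sum (λ e → iverson (e ∈? S))

indicator-+const : (S : Subset k) (x : Fin k → ℕ) (C : ℕ) →
                   ∀ e → indicator S (λ e → x e + C) e ≡ indicator S x e + C * iverson (e ∈? S)
indicator-+const S x C e with e ∈? S
... | yes _ = cong (x e +_) (sym (*-identityʳ C))
... | no  _ = sym (*-zeroʳ C)

weight-+const : ∀ {k} (S : Subset k) (x : Fin k → ℕ) (C : ℕ) → weight (λ e → x e + C) S ≡ weight x S + C * card S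
weight-+const {k} S x C = begin
  weight (λ e → x e + C) S                      ≡⟨ sumFin≡sum (indicator S (λ e → x e + C)) ⟩
  sum (indicator S (λ e → x e + C))             ≡⟨ sum-cong-≗ (indicator-+const S x C) ⟩
  sum (λ e → indicator S x e + C * inS e)       ≡⟨ ∑-distrib-+ (indicator S x) (λ e → C * inS e) ⟩
  sum (indicator S x) + sum (λ e → C * inS e)   ≡⟨ cong₂ _+_ (sym (sumFin≡sum (indicator S x))) (sym (*-distribˡ-sum C inS)) ⟩
  weight x S + C * card S                       ∎
  where
  open ≡-Reasoning
  inS : Fin k → ℕ
  inS e = iverson (e ∈? S)

Loopless : Graph → Set
Loopless G = ∀ e → ¬ (end₁ G e ≡ end₂ G e)

Covers : (G : Graph) → Subset (m G) → Fin (n G) → Set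
Covers G M v = ∃ λ e → e ∈ M × Incident G v e

covers? : (G : Graph) (M : Subset (m G)) → Decidable (Covers G M)
covers? G M v = any? (λ e → (e ∈? M) ×-dec incident? G v e)

degree : (G : Graph) → Subset (m G) → Fin (n G) → ℕ
degree G M v = sum (λ e → iverson ((e ∈? M) ×-dec incident? G v e))

IsMatching-antitone : (G : Graph) {I J M : Subset (m G)} → J ⊆ I → IsMatching G I M → IsMatching G J M
IsMatching-antitone G J⊆I (avoids , disjoint) = (λ e e∈M e∈J → avoids e e∈M (J⊆I e∈J)) , disjoint

sum-δ : (a : Fin k) → sum (λ v → iverson (a ≟ v)) ≡ 1
sum-δ a = ≤-antisym (sum-iverson-≤1 (a ≟_) (λ a≡i a≡j → trans (sym a≡i) a≡j)) (sum-iverson-≥1 (a ≟_) refl)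

sum-incident : (G : Graph) → Loopless G → ∀ e → sum (λ v → iverson (incident? G v e)) ≡ 2
sum-incident G loopless e = begin
  sum (λ v → iverson (incident? G v e))                              ≡⟨ sum-cong-≗ (λ v → iverson-⊎ (end₁ G e ≟ v) (end₂ G e ≟ v) ends-distinct) ⟩
  sum (λ v → iverson (end₁ G e ≟ v) + iverson (end₂ G e ≟ v))        ≡⟨ ∑-distrib-+ (λ v → iverson (end₁ G e ≟ v)) (λ v → iverson (end₂ G e ≟ v)) ⟩
  sum (λ v → iverson (end₁ G e ≟ v)) + sum (λ v → iverson (end₂ G e ≟ v)) ≡⟨ cong₂ _+_ (sum-δ (end₁ G e)) (sum-δ (end₂ G e)) ⟩
  2                                                                   ∎
  where
  open ≡-Reasoning
  ends-distinct : ∀ {v} → ¬ (end₁ G e ≡ v × end₂ G e ≡ v)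
  ends-distinct (e₁≡v , e₂≡v) = loopless e (trans e₁≡v (sym e₂≡v))

handshake : (G : Graph) → Loopless G → (M : Subset (m G)) → sum (degree G M) ≡ 2 * card M
handshake G loopless M = begin
  sum (λ v → sum (λ e → iverson (M∋ e ×-dec incident? G v e)))   ≡⟨ ∑-comm (λ v e → iverson (M∋ e ×-dec incident? G v e)) ⟩
  sum (λ e → sum (λ v → iverson (M∋ e ×-dec incident? G v e)))   ≡⟨ sum-cong-≗ (λ e → sum-cong-≗ (λ v → iverson-× (M∋ e) (incident? G v e))) ⟩
  sum (λ e → sum (λ v → iverson (M∋ e) * incidence e v))         ≡⟨ sum-cong-≗ (λ e → sym (*-distribˡ-sum (iverson (M∋ e)) (incidence e))) ⟩
  sum (λ e → iverson (M∋ e) * sum (incidence e))                 ≡⟨ sum-cong-≗ (λ e → cong (iverson (M∋ e) *_) (sum-incident G loopless e)) ⟩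
  sum (λ e → iverson (M∋ e) * 2)                                 ≡⟨ sym (*-distribʳ-sum 2 (iverson ∘ M∋)) ⟩
  card M * 2                                                     ≡⟨ *-comm (card M) 2 ⟩
  2 * card M                                                     ∎
  where
  open ≡-Reasoning
  M∋ : Decidable (_∈ M)
  M∋ e = e ∈? M
  incidence : Fin (m G) → Fin (n G) → ℕ
  incidence e v = iverson (incident? G v e)

module _ (G : Graph) {I M : Subset (m G)} (matching : IsMatching G I M) where

  degree≤1 : ∀ v → degree G M v ≤ 1
  degree≤1 v = sum-iverson-≤1 (λ e → (e ∈? M) ×-dec incident? G v e) unique
    where
    unique : ∀ {e f} → e ∈ M × Incident G v e → f ∈ M × Incident G v f → e ≡ f
    unique {e} {f} (e∈M , v∈e) (f∈M , v∈f) with e ≟ f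
    ... | yes e≡f = e≡f
    ... | no  e≢f = ⊥-elim (proj₂ matching e f e∈M f∈M e≢f v v∈e v∈f)

  covered⇒degree≡1 : ∀ {v} → Covers G M v → degree G M v ≡ 1
  covered⇒degree≡1 {v} (e , covers) =
    ≤-antisym (degree≤1 v) (sum-iverson-≥1 (λ e → (e ∈? M) ×-dec incident? G v e) covers)

  uncovered⇒degree≡0 : ∀ {v} → ¬ Covers G M v → degree G M v ≡ 0
  uncovered⇒degree≡0 {v} ¬covers = sum-iverson-≡0 (λ e → (e ∈? M) ×-dec incident? G v e) (λ e p → ¬covers (e , p))

  perfect⇒2card≡n : Loopless G → (∀ v → Covers G M v) → 2 * card M ≡ n G
  perfect⇒2card≡n loopless covers = begin
    2 * card M              ≡⟨ sym (handshake G loopless M) ⟩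
    sum (degree G M)        ≡⟨ sum-cong-≗ (λ v → covered⇒degree≡1 (covers v)) ⟩
    sum {n G} (λ _ → 1)     ≡⟨ sum-ones ⟩
    n G                     ∎
    where open ≡-Reasoning

  imperfect⇒2card<n : Loopless G → ¬ (∀ v → Covers G M v) → 2 * card M < n G
  imperfect⇒2card<n loopless ¬perfect with ¬∀⟶∃¬ (n G) (Covers G M) (covers? G M) ¬perfect
  ... | v , ¬covers = subst (_< n G) (handshake G loopless M)
                        (sum-<-ones (degree G M) degree≤1 v (uncovered⇒degree≡0 ¬covers))

module _ (G : Graph) (loopless : Loopless G) (x : Fin (m G) → ℕ) (I : Subset (m G))
         (N : ℕ) (N-bound : ∀ M → IsMatching G I M → weight x M ≤ N) where

  private
    x″ : Fin (m G) → ℕ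
    x″ e = x e + 2 * N + 2

  weight-reweighted : ∀ M → weight x″ M ≡ weight x M + suc N * (2 * card M)
  weight-reweighted M = begin
    weight x″ M                                  ≡⟨ weight-+const M (λ e → x e + 2 * N) 2 ⟩
    weight (λ e → x e + 2 * N) M + 2 * card M    ≡⟨ cong (_+ 2 * card M) (weight-+const M x (2 * N)) ⟩
    weight x M + 2 * N * card M + 2 * card M     ≡⟨ regroup (weight x M) N (card M) ⟩
    weight x M + suc N * (2 * card M)            ∎
    where
    open ≡-Reasoning
    regroup : ∀ w N c → w + 2 * N * c + 2 * c ≡ w + suc N * (2 * c)
    regroup = solve-∀

  weight-reweighted-perfect : ∀ {M} → IsPerfectMatching G I M → weight x″ M ≡ weight x M + suc N * n G
  weight-reweighted-perfect {M} (matching , covers) = trans (weight-reweighted M)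
    (cong (λ t → weight x M + suc N * t) (perfect⇒2card≡n G matching loopless covers))

  weight-reweighted-imperfect : ∀ {M} → IsMatching G I M → ¬ IsPerfectMatching G I M → weight x″ M < suc N * n G
  weight-reweighted-imperfect {M} matching ¬perfect = begin-strict
    weight x″ M                          ≡⟨ weight-reweighted M ⟩
    weight x M + suc N * (2 * card M)    ≤⟨ +-monoˡ-≤ _ (N-bound M matching) ⟩
    N + suc N * (2 * card M)             <⟨ +-monoˡ-< _ (n<1+n N) ⟩
    suc N + suc N * (2 * card M)         ≡⟨ sym (*-suc (suc N) (2 * card M)) ⟩
    suc N * suc (2 * card M)             ≤⟨ *-monoʳ-≤ (suc N) 2card<n ⟩
    suc N * n G                          ∎
    where
    open ≤-Reasoning
    2card<n : 2 * card M < n G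
    2card<n = imperfect⇒2card<n G matching loopless (λ covers → ¬perfect (matching , covers))

  γ+bonus≤ν-reweighted : HasPerfectMatching G I → γ G x I + suc N * n G ≤ ν G x″ I
  γ+bonus≤ν-reweighted (_ , perfectP) with maxWeightOver-attained (isPerfectMatching? G I) x perfectP
  ... | M , perfect , weight≡γ = begin
    γ G x I + suc N * n G      ≡⟨ cong (_+ suc N * n G) (sym weight≡γ) ⟩
    weight x M + suc N * n G   ≡⟨ sym (weight-reweighted-perfect perfect) ⟩
    weight x″ M                ≤⟨ weight≤maxWeightOver (isMatching? G I) x″ (proj₁ perfect) ⟩
    ν G x″ I                   ∎
    where open ≤-Reasoning

  ν-reweighted≤γ+bonus : ν G x″ I ≤ γ G x I + suc N * n G
  ν-reweighted≤γ+bonus = maxWeightOver-least (isMatching? G I) x″ bound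
    where
    bound : ∀ M → IsMatching G I M → weight x″ M ≤ γ G x I + suc N * n G
    bound M matching with isPerfectMatching? G I M
    ... | yes perfect = begin
      weight x″ M                ≡⟨ weight-reweighted-perfect perfect ⟩
      weight x M + suc N * n G   ≤⟨ +-monoˡ-≤ _ (weight≤maxWeightOver (isPerfectMatching? G I) x perfect) ⟩
      γ G x I + suc N * n G      ∎
      where open ≤-Reasoning
    ... | no ¬perfect =
      ≤-trans (<⇒≤ (weight-reweighted-imperfect matching ¬perfect)) (m≤n+m (suc N * n G) (γ G x I))

  γ+bonus≡ν-reweighted : HasPerfectMatching G I → γ G x I + n G * N + n G ≡ ν G (λ e → x e + 2 * N + 2) I
  γ+bonus≡ν-reweighted hasPerfect = begin
    γ G x I + n G * N + n G   ≡⟨ regroup (γ G x I) (n G) N ⟩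
    γ G x I + suc N * n G     ≡⟨ ≤-antisym (γ+bonus≤ν-reweighted hasPerfect) ν-reweighted≤γ+bonus ⟩
    ν G x″ I                  ∎
    where
    open ≡-Reasoning
    regroup : ∀ g n N → g + n * N + n ≡ g + suc N * n
    regroup = solve-∀

lemma4 : (G : Graph) → IsSimple G →
         (w c : Fin (m G) → ℕ) → (B : ℕ) → 0 < B →
         (∀ (I : Subset (m G)) → weight c I ≤ B → HasPerfectMatching G I) →
         let W   = maxWeight w
             w′  = λ e → W ∸ w e
             w″  = λ e → w′ e + 2 * ν G w′ (noEdges (m G)) + 2
         in ∀ (I : Subset (m G)) → weight c I ≤ B →
            γ G w′ I + n G * ν G w′ (noEdges (m G)) + n G ≡ ν G w″ I
lemma4 G (loopless , _) w c B _ robust I affordable =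
  γ+bonus≡ν-reweighted G loopless w′ I (ν G w′ (noEdges (m G))) ν-bound (robust I affordable)
  where
  w′ : Fin (m G) → ℕ
  w′ e = maxWeight w ∸ w e
  ν-bound : ∀ M → IsMatching G I M → weight w′ M ≤ ν G w′ (noEdges (m G))
  ν-bound M matching = weight≤maxWeightOver (isMatching? G (noEdges (m G))) w′ (IsMatching-antitone G ⊥⊆ matching)
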